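{- For every normal default theory $(D,W)$ with $W$ consistent and finite, there exists a set $D'$ of prerequisite-free normal defaults such that $\mathrm{ext}(D',\emptyset)=\mathrm{ext}(D,W)$.
   Context: $\mathcal L$ is the set of formulas of a propositional language over a denumerable set of atoms; $Cn$ denotes propositional consequence, and a theory is a subset of $\mathcal L$ closed under $Cn$. A default is an expression $d=\frac{\alpha:\Gamma}{\beta}$ with $\alpha,\beta\in\mathcal L$ and $\Gamma$ a finite subset of $\mathcal L$; write $p(d)=\alpha$, $j(d)=\Gamma$, $c(d)=\beta$; $d$ is prerequisite-free if $\alpha$ is a tautology and normal if it has the form $\frac{\alpha:\beta}{\beta}$. A default theory is a pair $(D,W)$ with $D$ a set of defaults and $W\subseteq\mathcal L$; it is normal if all its defaults are. For a theory $S$, $d$ is $S$-applicable if $S\not\vdash\neg\gamma$ for every $\gamma\in j(d)$. The reduct $D_S$ is the set of monotone rules $\frac{p(d)}{c(d)}$ for $S$-applicable $d\in D$, and $Cn^{D_S}(W)$ is the set of formulas provable from $W$ in propositional calculus extended by the rules in $D_S$. A theory $S$ is an extension of $(D,W)$ iff $S=Cn^{D_S}(W)$; $\mathrm{ext}(D,W)$ denotes the family of all extensions. -}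

module Defs where

open import Data.Nat using (ℕ)
open import Data.Bool using (Bool; true; false; not; _∧_; _∨_)
open import Data.List using (List; [])
open import Data.List.Relation.Unary.All using (All)
open import Data.List.Membership.Propositional using (_∈_)
open import Data.Product using (Σ; _×_; ∃)
open import Data.Empty using (⊥)
open import Relation.Nullary using (¬_)
open import Relation.Binary.PropositionalEquality using (_≡_)

data Formula : Set where
  var  : ℕ → Formula
  ⊥ᶠ   : Formula
  ⊤ᶠ   : Formula
  ¬ᶠ_  : Formula → Formula
  _∧ᶠ_ : Formula → Formula → Formula
  _∨ᶠ_ : Formula → Formula → Formula
  _⇒ᶠ_ : Formula → Formula → Formula

Valuation : Set
Valuation = ℕ → Bool

⟦_⟧ : Formula → Valuation → Bool
⟦ var n ⟧ v   = v n
⟦ ⊥ᶠ ⟧ v      = false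
⟦ ⊤ᶠ ⟧ v      = true
⟦ ¬ᶠ a ⟧ v    = not (⟦ a ⟧ v)
⟦ a ∧ᶠ b ⟧ v  = ⟦ a ⟧ v ∧ ⟦ b ⟧ v
⟦ a ∨ᶠ b ⟧ v  = ⟦ a ⟧ v ∨ ⟦ b ⟧ v
⟦ a ⇒ᶠ b ⟧ v  = not (⟦ a ⟧ v) ∨ ⟦ b ⟧ v

_⊨_ : List Formula → Formula → Set
Δ ⊨ φ = ∀ (v : Valuation) → All (λ ψ → ⟦ ψ ⟧ v ≡ true) Δ → ⟦ φ ⟧ v ≡ true

Tautology : Formula → Set
Tautology φ = [] ⊨ φ

FSet : Set₁
FSet = Formula → Set

-- Closure under propositional consequence is finitary (compactness is
-- built in: a formula follows from finitely many derived formulas).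

data Cn^ (R : Formula → Formula → Set) (W : FSet) : FSet where
  hyp  : ∀ {φ} → W φ → Cn^ R W φ
  cons : ∀ {φ} (Δ : List Formula) → All (Cn^ R W) Δ → Δ ⊨ φ → Cn^ R W φ
  rule : ∀ {α β} → R α β → Cn^ R W α → Cn^ R W β

NoRules : Formula → Formula → Set
NoRules _ _ = ⊥

Cn : FSet → FSet
Cn = Cn^ NoRules

record Default : Set where
  constructor _∶_/_
  field
    p : Formula
    j : List Formula
    c : Formula
open Default public

DSet : Set₁
DSet = Default → Set

PrerequisiteFree : Default → Set
PrerequisiteFree d = Tautology (p d)

Normal : Default → Set
Normal d = Σ Formula λ β → (j d ≡ (β Data.List.∷ [])) × (c d ≡ β)

NormalTheory : DSet → Set
NormalTheory D = ∀ d → D d → Normal d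

Applicable : FSet → Default → Set
Applicable S d = ∀ γ → γ ∈ j d → ¬ Cn S (¬ᶠ γ)

Reduct : DSet → FSet → Formula → Formula → Set
Reduct D S α β = Σ Default λ d → D d × Applicable S d × (p d ≡ α) × (c d ≡ β)

IsExtension : DSet → FSet → FSet → Set
IsExtension D W S = ∀ φ → (S φ → Cn^ (Reduct D S) W φ) × (Cn^ (Reduct D S) W φ → S φ)

setOf : List Formula → FSet
setOf L φ = φ ∈ L

∅ : FSet
∅ _ = ⊥

Consistent : FSet → Set
Consistent W = ¬ Cn W ⊥ᶠ

-- Let w be the conjunction of W. Call a formula reachable if it is w, or ψ ∧ c(d) for a reachable ψ
-- and a default d ∈ D whose prerequisite follows from ψ. Take D′ = { ⊤ : ψ / ψ | ψ reachable }.
-- Since D is normal, a whole chain w, w ∧ c(d₁), … is applicable with respect to S exactly when its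
-- last conjunction is consistent with S; so a reachable formula consistent with S lies in every
-- theory that contains w and is closed under the reduct D_S, while every formula of Cn^{D_S}(W)
-- follows from a reachable formula in S. Consistency of W makes every extension of (D, W)
-- consistent and keeps an extension of (D′, ∅) from refuting w.
module Submission where

open import Defs
open import Data.Bool using (true; false; not; _∧_)
open import Data.Empty using (⊥-elim)
open import Data.List using (List; []; _∷_; foldr)
open import Data.List.Membership.Propositional using (_∈_)
open import Data.List.Relation.Unary.All using (All; []; _∷_; lookup; tabulate) renaming (map to All-map)
open import Data.List.Relation.Unary.Any using (here; there)
open import Data.Product using (Σ; _×_; _,_; proj₁; proj₂; uncurry)
open import Relation.Binary.PropositionalEquality using (_≡_; refl; sym; trans; cong; cong₂)
open import Relation.Nullary using (¬_; contradiction)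

private variable
  S T X Y : FSet
  D : DSet
  W Γ Δ : List Formula
  φ ψ : Formula

∧-trueˡ : ∀ {x y} → x ∧ y ≡ true → x ≡ true
∧-trueˡ {true} _ = refl
∧-trueˡ {false} ()

∧-trueʳ : ∀ {x y} → x ∧ y ≡ true → y ≡ true
∧-trueʳ {true} h = h
∧-trueʳ {false} ()

-- A record around `_⊨_`, which unfolds to a function type from which Agda cannot infer the formulas.
record _⊩_ (Γ : List Formula) (φ : Formula) : Set where
  constructor ⊨⇒⊩
  field ⊩⇒⊨ : Γ ⊨ φ
open _⊩_

⊩-assumption : φ ∈ Γ → Γ ⊩ φ
⊩-assumption φ∈Γ = ⊨⇒⊩ λ v hv → lookup hv φ∈Γ

⊩-here : (φ ∷ Γ) ⊩ φ
⊩-here = ⊩-assumption (here refl)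

⊩-weaken : Γ ⊩ φ → (ψ ∷ Γ) ⊩ φ
⊩-weaken (⊨⇒⊩ e) = ⊨⇒⊩ λ { v (_ ∷ hv) → e v hv }

⊩-cut : All (Γ ⊩_) Δ → Δ ⊩ φ → Γ ⊩ φ
⊩-cut es (⊨⇒⊩ e) = ⊨⇒⊩ λ v hv → e v (All-map (λ eψ → ⊩⇒⊨ eψ v hv) es)

⊩-∧-intro : Γ ⊩ φ → Γ ⊩ ψ → Γ ⊩ (φ ∧ᶠ ψ)
⊩-∧-intro (⊨⇒⊩ eφ) (⊨⇒⊩ eψ) = ⊨⇒⊩ λ v hv → cong₂ _∧_ (eφ v hv) (eψ v hv)

⊩-∧-elimˡ : Γ ⊩ (φ ∧ᶠ ψ) → Γ ⊩ φ
⊩-∧-elimˡ (⊨⇒⊩ e) = ⊨⇒⊩ λ v hv → ∧-trueˡ (e v hv)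

⊩-∧-elimʳ : Γ ⊩ (φ ∧ᶠ ψ) → Γ ⊩ ψ
⊩-∧-elimʳ {φ = φ} (⊨⇒⊩ e) = ⊨⇒⊩ λ v hv → ∧-trueʳ {⟦ φ ⟧ v} (e v hv)

⊩-¬-intro : (φ ∷ Γ) ⊩ ⊥ᶠ → Γ ⊩ (¬ᶠ φ)
⊩-¬-intro {φ = φ} (⊨⇒⊩ e) = ⊨⇒⊩ λ v hv → by-cases v hv
  where
  by-cases : ∀ v → All (λ ψ → ⟦ ψ ⟧ v ≡ true) _ → ⟦ ¬ᶠ φ ⟧ v ≡ true
  by-cases v hv with ⟦ φ ⟧ v in eq
  ... | false = refl
  ... | true = e v (eq ∷ hv)

⊩-¬-elim : Γ ⊩ φ → Γ ⊩ (¬ᶠ φ) → Γ ⊩ ⊥ᶠ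
⊩-¬-elim (⊨⇒⊩ eφ) (⊨⇒⊩ e¬φ) = ⊨⇒⊩ λ v hv → trans (cong not (sym (eφ v hv))) (e¬φ v hv)

⊩-⊥-elim : Γ ⊩ ⊥ᶠ → Γ ⊩ φ
⊩-⊥-elim (⊨⇒⊩ e) = ⊨⇒⊩ λ v hv → contradiction (e v hv) λ ()

∧ᶠ-intro : (φ ∷ ψ ∷ []) ⊩ (φ ∧ᶠ ψ)
∧ᶠ-intro = ⊩-∧-intro ⊩-here (⊩-weaken ⊩-here)

¬ᶠ-contradiction : (φ ∷ ¬ᶠ φ ∷ []) ⊩ ⊥ᶠ
¬ᶠ-contradiction = ⊩-¬-elim ⊩-here (⊩-weaken ⊩-here)

contraposition : (φ ∷ []) ⊩ ψ → (¬ᶠ ψ ∷ []) ⊩ (¬ᶠ φ)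
contraposition e = ⊩-¬-intro (⊩-¬-elim (⊩-cut (⊩-here ∷ []) e) (⊩-weaken ⊩-here))

¬∧ᶠ-elim : (φ ∷ ¬ᶠ (φ ∧ᶠ ψ) ∷ []) ⊩ (¬ᶠ ψ)
¬∧ᶠ-elim = ⊩-¬-intro (⊩-¬-elim (⊩-∧-intro (⊩-weaken ⊩-here) ⊩-here)
                                 (⊩-weaken (⊩-weaken ⊩-here)))

⋀ : List Formula → Formula
⋀ = foldr _∧ᶠ_ ⊤ᶠ

⋀-intro : Δ ⊩ ⋀ Δ
⋀-intro {[]} = ⊨⇒⊩ λ _ _ → refl
⋀-intro {φ ∷ Δ} = ⊩-∧-intro ⊩-here (⊩-weaken ⋀-intro)

⋀-elim : φ ∈ Δ → (⋀ Δ ∷ []) ⊩ φ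
⋀-elim (here refl) = ⊩-∧-elimˡ ⊩-here
⋀-elim (there φ∈Δ) = ⊩-cut (⊩-∧-elimʳ ⊩-here ∷ []) (⋀-elim φ∈Δ)

Closed : FSet → Set
Closed S = ∀ {Δ φ} → All S Δ → Δ ⊩ φ → S φ

ClosedUnder : (Formula → Formula → Set) → FSet → Set
ClosedUnder R S = ∀ {α β} → R α β → S α → S β

module _ {R : Formula → Formula → Set} {X : FSet} (P : FSet)
         (hyp-case : ∀ {φ} → X φ → P φ)
         (cons-case : ∀ {Δ φ} → All P Δ → Δ ⊩ φ → P φ)
         (rule-case : ∀ {α β} → R α β → Cn^ R X α → P α → P β) where

  Cn^-ind : Cn^ R X φ → P φ
  Cn^-ind-All : All (Cn^ R X) Δ → All P Δ

  Cn^-ind (hyp x) = hyp-case x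
  Cn^-ind (cons _ premises e) = cons-case (Cn^-ind-All premises) (⊨⇒⊩ e)
  Cn^-ind (rule r premise) = rule-case r premise (Cn^-ind premise)

  Cn^-ind-All [] = []
  Cn^-ind-All (premise ∷ premises) = Cn^-ind premise ∷ Cn^-ind-All premises

Cn^-closed : ∀ {R} → Closed (Cn^ R X)
Cn^-closed premises e = cons _ premises (⊩⇒⊨ e)

module _ {R : Formula → Formula → Set} where

  Cn^-⊤ : Cn^ R X ⊤ᶠ
  Cn^-⊤ = Cn^-closed [] (⊨⇒⊩ λ _ _ → refl)

  Cn^-⋀ : Cn^ R (setOf W) (⋀ W)
  Cn^-⋀ = Cn^-closed (tabulate hyp) ⋀-intro

  Cn^-without-rules : (∀ {α β} → ¬ R α β) → (∀ {φ} → X φ → Cn Y φ) → Cn^ R X φ → Cn Y φ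
  Cn^-without-rules {Y = Y} noRule embed = Cn^-ind (Cn Y) embed Cn^-closed (λ r _ _ → ⊥-elim (noRule r))

Closed⇒Cn⊆ : Closed S → Cn S φ → S φ
Closed⇒Cn⊆ {S} closed = Cn^-ind S (λ s → s) closed (λ ())

ConsistentWith : FSet → Formula → Set
ConsistentWith S φ = ¬ Cn S (¬ᶠ φ)

member⇒consistentWith : Consistent S → S φ → ConsistentWith S φ
member⇒consistentWith consS s refutation = consS (Cn^-closed (hyp s ∷ refutation ∷ []) ¬ᶠ-contradiction)

consistentWith-weaken : (φ ∷ []) ⊩ ψ → ConsistentWith S φ → ConsistentWith S ψ
consistentWith-weaken e h refutation = h (Cn^-closed (refutation ∷ []) (contraposition e))

consistentWith-∧ : Cn S φ → ConsistentWith S ψ → ConsistentWith S (φ ∧ᶠ ψ)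
consistentWith-∧ φ∈S h refutation = h (Cn^-closed (φ∈S ∷ refutation ∷ []) ¬∧ᶠ-elim)

normal-applicable : ∀ d → Normal d → ConsistentWith S (c d) → Applicable S d
normal-applicable (_ ∶ _ / _) (_ , refl , refl) h _ (here refl) = h

applicable-normal : ∀ d → Normal d → Applicable S d → ConsistentWith S (c d)
applicable-normal (_ ∶ _ / _) (β , refl , refl) app = app β (here refl)

module Extension {D : DSet} {X S : FSet} (ext : IsExtension D X S) where

  ⊆Cn^ : S φ → Cn^ (Reduct D S) X φ
  ⊆Cn^ {φ} = proj₁ (ext φ)

  Cn^⊆ : Cn^ (Reduct D S) X φ → S φ
  Cn^⊆ {φ} = proj₂ (ext φ)

  closed : Closed S
  closed premises e = Cn^⊆ (Cn^-closed (All-map ⊆Cn^ premises) e)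

  closedUnder : ClosedUnder (Reduct D S) S
  closedUnder r s = Cn^⊆ (rule r (⊆Cn^ s))

  ⊤ᶠ∈ : S ⊤ᶠ
  ⊤ᶠ∈ = Cn^⊆ Cn^-⊤

normal-extension-consistent : NormalTheory D → Consistent X → IsExtension D X S → Consistent S
normal-extension-consistent {D} {X} {S} nt consX ext inconsistent =
  consX (Cn^-without-rules noRule hyp (⊆Cn^ (Closed⇒Cn⊆ closed inconsistent)))
  where
  open Extension ext
  noRule : ∀ {α β} → ¬ Reduct D S α β
  noRule (d , Dd , app , _ , _) =
    applicable-normal d (nt d Dd) app (Cn^-closed (inconsistent ∷ []) (⊩-⊥-elim ⊩-here))

data Reach (D : DSet) (W : List Formula) : FSet where
  base : Reach D W (⋀ W)
  step : ∀ {φ} d → D d → (φ ∷ []) ⊩ p d → Reach D W φ → Reach D W (φ ∧ᶠ c d)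

reach⇒⋀ : Reach D W ψ → (ψ ∷ []) ⊩ ⋀ W
reach⇒⋀ base = ⊩-here
reach⇒⋀ (step _ _ _ g) = ⊩-cut (⊩-∧-elimˡ ⊩-here ∷ []) (reach⇒⋀ g)

reach-∧ : Reach D W φ → Reach D W ψ →
          Σ Formula λ χ → Reach D W χ × (χ ∷ []) ⊩ φ × (χ ∷ []) ⊩ ψ × (φ ∷ ψ ∷ []) ⊩ χ
reach-∧ gφ base = _ , gφ , ⊩-here , reach⇒⋀ gφ , ⊩-here
reach-∧ gφ (step d Dd e gψ) with reach-∧ gφ gψ
... | χ , gχ , χ⊩φ , χ⊩ψ , φψ⊩χ =
  χ ∧ᶠ c d , step d Dd (⊩-cut (χ⊩ψ ∷ []) e) gχ ,
  ⊩-cut (⊩-∧-elimˡ ⊩-here ∷ []) χ⊩φ ,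
  ⊩-∧-intro (⊩-cut (⊩-∧-elimˡ ⊩-here ∷ []) χ⊩ψ) (⊩-∧-elimʳ ⊩-here) ,
  ⊩-∧-intro (⊩-cut (⊩-here ∷ ⊩-∧-elimˡ (⊩-weaken ⊩-here) ∷ []) φψ⊩χ) (⊩-∧-elimʳ (⊩-weaken ⊩-here))

consistent-reachable-∈ : NormalTheory D → Closed T → T (⋀ W) → ClosedUnder (Reduct D S) T →
                         Reach D W ψ → ConsistentWith S ψ → T ψ
consistent-reachable-∈ nt closed ⋀∈T rules base _ = ⋀∈T
consistent-reachable-∈ {D} {T} {W} {S} nt closed ⋀∈T rules (step {φ} d Dd e g) h =
  closed (φ∈T ∷ cd∈T ∷ []) ∧ᶠ-intro
  where
  φ∈T : T φ
  φ∈T = consistent-reachable-∈ nt closed ⋀∈T rules g (consistentWith-weaken (⊩-∧-elimˡ ⊩-here) h)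
  applicable : Applicable S d
  applicable = normal-applicable d (nt d Dd) (consistentWith-weaken (⊩-∧-elimʳ ⊩-here) h)
  cd∈T : T (c d)
  cd∈T = rules (d , Dd , applicable , refl , refl) (closed (φ∈T ∷ []) e)

data Supported (D : DSet) (W : List Formula) (S : FSet) (φ : Formula) : Set where
  supported : Reach D W ψ → S ψ → (ψ ∷ []) ⊩ φ → Supported D W S φ

common-support : Closed S → S (⋀ W) → All (Supported D W S) Δ →
                 Σ Formula λ ψ → Reach D W ψ × S ψ × All ((ψ ∷ []) ⊩_) Δ
common-support closed ⋀∈S [] = _ , base , ⋀∈S , []
common-support closed ⋀∈S (supported g₁ s₁ e₁ ∷ rest) with common-support closed ⋀∈S rest
... | _ , g₂ , s₂ , es₂ with reach-∧ g₁ g₂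
... | χ , g , χ⊩ψ₁ , χ⊩ψ₂ , ψ₁ψ₂⊩χ =
  χ , g , closed (s₁ ∷ s₂ ∷ []) ψ₁ψ₂⊩χ ,
  ⊩-cut (χ⊩ψ₁ ∷ []) e₁ ∷ All-map (λ e₂ → ⊩-cut (χ⊩ψ₂ ∷ []) e₂) es₂

supported-closed : Closed S → S (⋀ W) → Closed (Supported D W S)
supported-closed closed ⋀∈S premises e with common-support closed ⋀∈S premises
... | _ , g , s , es = supported g s (⊩-cut es e)

freeDefaults : DSet → List Formula → DSet
freeDefaults D W d = Σ Formula λ ψ → Reach D W ψ × (d ≡ (⊤ᶠ ∶ ψ ∷ [] / ψ))

freeDefaults-prerequisiteFree-normal : ∀ d → freeDefaults D W d → PrerequisiteFree d × Normal d
freeDefaults-prerequisiteFree-normal _ (ψ , _ , refl) = (λ _ _ → refl) , (ψ , refl , refl)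

freeDefaults-reduct : Reach D W ψ → ConsistentWith S ψ → Reduct (freeDefaults D W) S ⊤ᶠ ψ
freeDefaults-reduct {ψ = ψ} g h =
  _ , (ψ , g , refl) , normal-applicable (⊤ᶠ ∶ ψ ∷ [] / ψ) (ψ , refl , refl) h , refl , refl

freeDefaults-reduct⁻¹ : ∀ {α β} → Reduct (freeDefaults D W) S α β → Reach D W β × ConsistentWith S β
freeDefaults-reduct⁻¹ (_ , (ψ , g , refl) , app , _ , refl) = g , app ψ (here refl)

extension⇒freeExtension : NormalTheory D → Consistent (setOf W) →
                          IsExtension D (setOf W) S → IsExtension (freeDefaults D W) ∅ S
extension⇒freeExtension {D} {W} {S} nt consW ext _ = S⊆ , ⊆S
  where
  open Extension ext
  consS : Consistent S
  consS = normal-extension-consistent nt consW ext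
  ⋀∈S : S (⋀ W)
  ⋀∈S = closed (tabulate (λ φ∈W → Cn^⊆ (hyp φ∈W))) ⋀-intro
  support : ∀ {φ} → Cn^ (Reduct D S) (setOf W) φ → Supported D W S φ
  support = Cn^-ind _ (λ φ∈W → supported base ⋀∈S (⋀-elim φ∈W)) (supported-closed closed ⋀∈S) apply
    where
    apply : ∀ {α β} → Reduct D S α β → Cn^ (Reduct D S) (setOf W) α →
            Supported D W S α → Supported D W S β
    apply r@(d , Dd , _ , refl , refl) _ (supported {ψ} g ψ∈S e) =
      supported (step d Dd e g) ψ∧cd∈S (⊩-∧-elimʳ ⊩-here)
      where
      ψ∧cd∈S : S (ψ ∧ᶠ c d)
      ψ∧cd∈S = closed (ψ∈S ∷ closedUnder r (closed (ψ∈S ∷ []) e) ∷ []) ∧ᶠ-intro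
  S⊆ : ∀ {φ} → S φ → Cn^ (Reduct (freeDefaults D W) S) ∅ φ
  S⊆ s with support (⊆Cn^ s)
  ... | supported g ψ∈S e =
    Cn^-closed (rule (freeDefaults-reduct g (member⇒consistentWith consS ψ∈S)) Cn^-⊤ ∷ []) e
  ⊆S : ∀ {φ} → Cn^ (Reduct (freeDefaults D W) S) ∅ φ → S φ
  ⊆S = Cn^-ind S (λ ()) closed
         (λ r _ _ → uncurry (consistent-reachable-∈ nt closed ⋀∈S closedUnder) (freeDefaults-reduct⁻¹ r))

freeExtension⇒extension : NormalTheory D → Consistent (setOf W) →
                          IsExtension (freeDefaults D W) ∅ S → IsExtension D (setOf W) S
freeExtension⇒extension {D} {W} {S} nt consW ext _ = S⊆ , ⊆S
  where
  open Extension ext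
  ⋀-consistentWith : ConsistentWith S (⋀ W)
  ⋀-consistentWith refutation =
    consW (Cn^-closed (Cn^-⋀ ∷ W⊢¬⋀W ∷ []) ¬ᶠ-contradiction)
    where
    noRule : ∀ {α β} → ¬ Reduct (freeDefaults D W) S α β
    noRule r with freeDefaults-reduct⁻¹ r
    ... | g , h = consistentWith-weaken (reach⇒⋀ g) h refutation
    W⊢¬⋀W : Cn (setOf W) (¬ᶠ ⋀ W)
    W⊢¬⋀W = Cn^-without-rules noRule (λ ()) (⊆Cn^ (Closed⇒Cn⊆ closed refutation))
  ⋀∈S : S (⋀ W)
  ⋀∈S = closedUnder (freeDefaults-reduct base ⋀-consistentWith) ⊤ᶠ∈
  support : ∀ {φ} → Cn^ (Reduct (freeDefaults D W) S) ∅ φ → Supported D W S φ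
  support = Cn^-ind _ (λ ()) (supported-closed closed ⋀∈S)
              (λ r e _ → supported (proj₁ (freeDefaults-reduct⁻¹ r)) (closedUnder r (Cn^⊆ e)) ⊩-here)
  S⊆ : ∀ {φ} → S φ → Cn^ (Reduct D S) (setOf W) φ
  S⊆ s = Cn^-ind _ (λ ()) Cn^-closed
           (λ r _ _ → uncurry (consistent-reachable-∈ nt Cn^-closed Cn^-⋀ rule) (freeDefaults-reduct⁻¹ r))
           (⊆Cn^ s)
  ⊆S : ∀ {φ} → Cn^ (Reduct D S) (setOf W) φ → S φ
  ⊆S = Cn^-ind S (λ φ∈W → closed (⋀∈S ∷ []) (⋀-elim φ∈W)) closed apply
    where
    apply : ∀ {α β} → Reduct D S α β → Cn^ (Reduct D S) (setOf W) α → S α → S β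
    apply (d , Dd , app , refl , refl) _ pd∈S with support (⊆Cn^ pd∈S)
    ... | supported {ψ} g ψ∈S e = closed (ψ∧cd∈S ∷ []) (⊩-∧-elimʳ ⊩-here)
      where
      ψ∧cd-consistent : ConsistentWith S (ψ ∧ᶠ c d)
      ψ∧cd-consistent = consistentWith-∧ (hyp ψ∈S) (applicable-normal d (nt d Dd) app)
      ψ∧cd∈S : S (ψ ∧ᶠ c d)
      ψ∧cd∈S = closedUnder (freeDefaults-reduct (step d Dd e g) ψ∧cd-consistent) ⊤ᶠ∈

mainTheorem11 : (D : DSet) (W : List Formula) →
    NormalTheory D → Consistent (setOf W) →
    Σ DSet λ D′ → (∀ d → D′ d → PrerequisiteFree d × Normal d) ×
      (∀ (S : FSet) → (IsExtension D′ ∅ S → IsExtension D (setOf W) S)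
                    × (IsExtension D (setOf W) S → IsExtension D′ ∅ S))
mainTheorem11 D W nt consW =
  freeDefaults D W , freeDefaults-prerequisiteFree-normal ,
  λ S → freeExtension⇒extension nt consW , extension⇒freeExtension nt consW
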